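{- Consider the following six two-vertex Boolean networks $(f_1,f_2)$: $[1,00,01]$: $f_1=0,f_2=\neg x_1\land x_2$; $[2,00,01]$: $f_1=0,f_2=x_2$; $[3,00,01]$: $f_1=x_1\land x_2,f_2=\neg x_1\land x_2$; $[4,00,01]$: $f_1=0,f_2=x_1\oplus x_2$; $[5,00,01]$: $f_1=0,f_2=x_1\lor x_2$; $[8,00,01]$: $f_1=x_1\land\neg x_2,f_2=x_1\lor x_2$. For any delay vector $(\alpha,\beta)$, every MBN built on one of these networks has exactly two attractors, the fixed points $(0,0)$ and $(0,\beta)$.
   Context: The MBN built on a two-vertex Boolean network $(f_1,f_2)$ with delay vector $(\alpha,\beta)$ of positive integers has configurations $(\rho,\gamma)$ with $0\le\rho\le\alpha$, $0\le\gamma\le\beta$, underlying Boolean state $x=([\rho\ge1],[\gamma\ge1])$, and dynamics: the first coordinate becomes $\alpha$ if $f_1(x)=1$, else $\max(\rho-1,0)$; the second becomes $\beta$ if $f_2(x)=1$, else $\max(\gamma-1,0)$. Attractors are periodic orbits: fixed points (length 1) and limit cycles (length $\ge2$). $\oplus$ is exclusive or. -}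

module Defs where

open import Data.Bool using (Bool; true; false; not; _∧_; _∨_; _xor_; if_then_else_)
open import Data.Nat using (ℕ; zero; suc; _≤_; _<_; _≥_; _∸_; _⊔_; _≤ᵇ_)
open import Data.Nat.Properties using (m∸n≤m; ≤-refl)
open import Data.Product using (_×_; _,_; proj₁; proj₂; Σ; ∃)
open import Data.Sum using (_⊎_)
open import Relation.Binary.PropositionalEquality using (_≡_)
open import Relation.Nullary using (¬_)

BN2 : Set
BN2 = (Bool → Bool → Bool) × (Bool → Bool → Bool)

Config : ℕ → ℕ → Set
Config α β = Σ (ℕ × ℕ) λ p → (proj₁ p ≤ α) × (proj₂ p ≤ β)

pos : ℕ → Bool
pos zero = false
pos (suc _) = true

-- the underlying Boolean state x = ([ρ ≥ 1] , [γ ≥ 1])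
-- update of one coordinate: becomes the delay if f = 1, else max(r - 1, 0) = r ∸ 1
upd : Bool → ℕ → ℕ → ℕ
upd true  d r = d
upd false d r = r ∸ 1

upd-≤ : ∀ b {d r} → r ≤ d → upd b d r ≤ d
upd-≤ true  _ = ≤-refl
upd-≤ false {d} {r} h = Data.Nat.Properties.≤-trans (m∸n≤m r 1) h

step : (F : BN2) (α β : ℕ) → Config α β → Config α β
step (f₁ , f₂) α β ((ρ , γ) , hρ , hγ) =
  let x₁ = pos ρ ; x₂ = pos γ
      b₁ = f₁ x₁ x₂ ; b₂ = f₂ x₁ x₂
  in (upd b₁ α ρ , upd b₂ β γ) , upd-≤ b₁ hρ , upd-≤ b₂ hγ

iterate : ∀ {A : Set} → (A → A) → ℕ → A → A
iterate f zero    a = a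
iterate f (suc k) a = f (iterate f k a)

-- c lies on a periodic orbit (i.e. on some attractor)
Periodic : (F : BN2) (α β : ℕ) → Config α β → Set
Periodic F α β c = ∃ λ k → (1 ≤ k) × (iterate (step F α β) k c ≡ c)

FixedPoint : (F : BN2) (α β : ℕ) → Config α β → Set
FixedPoint F α β c = step F α β c ≡ c

coords : ∀ {α β} → Config α β → ℕ × ℕ
coords = proj₁

data Net : Set where
  n1 n2 n3 n4 n5 n8 : Net

network : Net → BN2
network n1 = (λ x₁ x₂ → false)          , (λ x₁ x₂ → not x₁ ∧ x₂)
network n2 = (λ x₁ x₂ → false)          , (λ x₁ x₂ → x₂)
network n3 = (λ x₁ x₂ → x₁ ∧ x₂)        , (λ x₁ x₂ → not x₁ ∧ x₂)
network n4 = (λ x₁ x₂ → false)          , (λ x₁ x₂ → x₁ xor x₂)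
network n5 = (λ x₁ x₂ → false)          , (λ x₁ x₂ → x₁ ∨ x₂)
network n8 = (λ x₁ x₂ → x₁ ∧ not x₂)    , (λ x₁ x₂ → x₁ ∨ x₂)

{-# OPTIONS --safe #-}
-- Only the coordinates (ρ , γ) matter.  Both (0 , 0) and (0 , β) are fixed by all six networks,
-- and from (0 , γ+1) every network jumps straight to (0 , β); so the set Rest of these two
-- states is forward invariant.  Each network admits a lexicographic measure on (ρ , γ) that
-- strictly decreases along every step not entering Rest.  On a periodic orbit outside Rest the
-- measure would come back to its initial value after strictly decreasing, which is absurd.
module Submission where

open import Defs
open import Data.Nat using (ℕ; zero; suc; _≤_; z≤n; s≤s)
open import Data.Nat.Properties using (≤-refl; ≤-irrelevant; n<1+n; <-strictPartialOrder)
import Data.Nat as ℕ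
open import Data.Product using (_×_; _,_; Σ)
open import Data.Product.Properties using (≡-dec)
open import Data.Product.Relation.Binary.Lex.Strict using (×-strictPartialOrder)
open import Data.Sum using (_⊎_; inj₁; inj₂)
open import Relation.Binary.Bundles using (StrictPartialOrder)
open import Relation.Binary.PropositionalEquality
  using (_≡_; refl; sym; trans; cong; cong₂; subst)
open import Relation.Nullary using (¬_; Dec; contradiction)
open import Relation.Nullary.Decidable using (_⊎-dec_; decidable-stable)

module Descent {b ℓ₁ ℓ₂} {A : Set} (O : StrictPartialOrder b ℓ₁ ℓ₂) where

  open StrictPartialOrder O using (_<_; irrefl; module Eq)
    renaming (Carrier to B; trans to <-trans)

  module _ (S : A → A) (R : A → Set) (μ : A → B)
           (R-closed : ∀ {x} → R x → R (S x))
           (μ-decreasing : ∀ x → ¬ R (S x) → μ (S x) < μ x) where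

    iterate-outside-decreasing : ∀ k {x} → ¬ R (iterate S (suc k) x) →
                                 μ (iterate S (suc k) x) < μ x
    iterate-outside-decreasing zero    {x} ¬R = μ-decreasing x ¬R
    iterate-outside-decreasing (suc k) {x} ¬R =
      <-trans (μ-decreasing (iterate S (suc k) x) ¬R)
              (iterate-outside-decreasing k (λ r → ¬R (R-closed r)))

    periodic⇒¬¬R : ∀ k {x} → iterate S (suc k) x ≡ x → ¬ ¬ R x
    periodic⇒¬¬R k {x} eq ¬R =
      irrefl Eq.refl (subst (λ y → μ y < μ x) eq
        (iterate-outside-decreasing k (λ r → ¬R (subst R eq r))))

stepℕ : BN2 → ℕ → ℕ → ℕ × ℕ → ℕ × ℕ
stepℕ (f₁ , f₂) α β (ρ , γ) = upd (f₁ (pos ρ) (pos γ)) α ρ , upd (f₂ (pos ρ) (pos γ)) β γ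

coords-step : ∀ F α β (c : Config α β) → coords (step F α β c) ≡ stepℕ F α β (coords c)
coords-step (f₁ , f₂) α β ((ρ , γ) , _) = refl

coords-iterate : ∀ F α β k (c : Config α β) →
                 coords (iterate (step F α β) k c) ≡ iterate (stepℕ F α β) k (coords c)
coords-iterate F α β zero    c = refl
coords-iterate F α β (suc k) c =
  trans (coords-step F α β (iterate (step F α β) k c))
        (cong (stepℕ F α β) (coords-iterate F α β k c))

coords-injective : ∀ {α β} {c d : Config α β} → coords c ≡ coords d → c ≡ d
coords-injective {c = p , h₁ , h₂} {d = .p , k₁ , k₂} refl =
  cong₂ (λ u v → p , u , v) (≤-irrelevant h₁ k₁) (≤-irrelevant h₂ k₂)

fixedPoint-from-coords : ∀ F α β (c : Config α β) →
                         stepℕ F α β (coords c) ≡ coords c → FixedPoint F α β c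
fixedPoint-from-coords F α β c eq = coords-injective (trans (coords-step F α β c) eq)

stepℕ-0,0 : ∀ N α β → stepℕ (network N) α β (0 , 0) ≡ (0 , 0)
stepℕ-0,0 n1 α β = refl
stepℕ-0,0 n2 α β = refl
stepℕ-0,0 n3 α β = refl
stepℕ-0,0 n4 α β = refl
stepℕ-0,0 n5 α β = refl
stepℕ-0,0 n8 α β = refl

stepℕ-0,suc : ∀ N α β γ → stepℕ (network N) α β (0 , suc γ) ≡ (0 , β)
stepℕ-0,suc n1 α β γ = refl
stepℕ-0,suc n2 α β γ = refl
stepℕ-0,suc n3 α β γ = refl
stepℕ-0,suc n4 α β γ = refl
stepℕ-0,suc n5 α β γ = refl
stepℕ-0,suc n8 α β γ = refl

Rest : ℕ → ℕ × ℕ → Set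
Rest β p = p ≡ (0 , 0) ⊎ p ≡ (0 , β)

Rest? : ∀ β p → Dec (Rest β p)
Rest? β p = ≡-dec ℕ._≟_ ℕ._≟_ p (0 , 0) ⊎-dec ≡-dec ℕ._≟_ ℕ._≟_ p (0 , β)

rest-closed : ∀ N α β {p} → Rest (suc β) p → Rest (suc β) (stepℕ (network N) α (suc β) p)
rest-closed N α β (inj₁ refl) = inj₁ (stepℕ-0,0 N α (suc β))
rest-closed N α β (inj₂ refl) = inj₂ (stepℕ-0,suc N α (suc β) β)

Lex : StrictPartialOrder _ _ _
Lex = ×-strictPartialOrder <-strictPartialOrder <-strictPartialOrder

open StrictPartialOrder Lex using () renaming (_<_ to _<ₗₑₓ_)

measure : Net → ℕ × ℕ → ℕ × ℕ
measure n3 (ρ , γ) = γ , ρ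
measure n8 (ρ , zero)  = 1 , ρ
measure n8 (ρ , suc _) = 0 , ρ
measure _  (ρ , γ) = ρ , 0

measure-decreasing-from-active : ∀ N α β r γ →
  measure N (stepℕ (network N) α (suc β) (suc r , γ)) <ₗₑₓ measure N (suc r , γ)
measure-decreasing-from-active n1 α β r γ       = inj₁ (n<1+n r)
measure-decreasing-from-active n2 α β r γ       = inj₁ (n<1+n r)
measure-decreasing-from-active n3 α β r zero    = inj₂ (refl , n<1+n r)
measure-decreasing-from-active n3 α β r (suc γ) = inj₁ (n<1+n γ)
measure-decreasing-from-active n4 α β r γ       = inj₁ (n<1+n r)
measure-decreasing-from-active n5 α β r γ       = inj₁ (n<1+n r)
measure-decreasing-from-active n8 α β r zero    = inj₁ (s≤s z≤n)
measure-decreasing-from-active n8 α β r (suc γ) = inj₂ (refl , n<1+n r)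

measure-decreasing : ∀ N α β p → ¬ Rest (suc β) (stepℕ (network N) α (suc β) p) →
  measure N (stepℕ (network N) α (suc β) p) <ₗₑₓ measure N p
measure-decreasing N α β (zero  , zero)  ¬rest =
  contradiction (inj₁ (stepℕ-0,0 N α (suc β))) ¬rest
measure-decreasing N α β (zero  , suc γ) ¬rest =
  contradiction (inj₂ (stepℕ-0,suc N α (suc β) γ)) ¬rest
measure-decreasing N α β (suc r , γ)     _     = measure-decreasing-from-active N α β r γ

periodic⇒rest : ∀ N α β (c : Config α (suc β)) → Periodic (network N) α (suc β) c →
                Rest (suc β) (coords c)
periodic⇒rest N α β c (suc k , _ , eq) =
  decidable-stable (Rest? (suc β) (coords c))
    (Descent.periodic⇒¬¬R Lex S (Rest (suc β)) (measure N)
       (rest-closed N α β) (measure-decreasing N α β) k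
       (trans (sym (coords-iterate (network N) α (suc β) (suc k) c)) (cong coords eq)))
  where
  S : ℕ × ℕ → ℕ × ℕ
  S = stepℕ (network N) α (suc β)

proposition9 : (N : Net) (α β : ℕ) → 1 ≤ α → 1 ≤ β →
    -- (0,0) and (0,β) are configurations that are fixed points, and they are distinct,
    (Σ (Config α β) λ c₀ → Σ (Config α β) λ c₁ →
        coords c₀ ≡ (0 , 0) × coords c₁ ≡ (0 , β) ×
        FixedPoint (network N) α β c₀ × FixedPoint (network N) α β c₁ ×
        ¬ coords c₀ ≡ coords c₁)
    -- and every configuration lying on an attractor (periodic orbit) is one of them
    × ((c : Config α β) → Periodic (network N) α β c →
        coords c ≡ (0 , 0) ⊎ coords c ≡ (0 , β))
proposition9 N α zero    _ ()
proposition9 N α (suc β) _ _ =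
  (c₀ , c₁ , refl , refl ,
   fixedPoint-from-coords (network N) α (suc β) c₀ (stepℕ-0,0 N α (suc β)) ,
   fixedPoint-from-coords (network N) α (suc β) c₁ (stepℕ-0,suc N α (suc β) β) ,
   λ ())
  , periodic⇒rest N α β
  where
  c₀ c₁ : Config α (suc β)
  c₀ = (0 , 0) , z≤n , z≤n
  c₁ = (0 , suc β) , z≤n , ≤-refl
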